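{- Let $G=\langle V,E\rangle$ be a finite simple undirected graph with vertex set $V=\{1,\dots,n\}$. For each vertex $i$ let $N(i)=\{j\in V : (i,j)\in E\}$ and $N[i]=N(i)\cup\{i\}$, and let $\mathrm{dist}(i,j)$ denote the graph distance. Consider the system in binary variables $x_j$ ($j\in V$) and real variables $y_{ij}$ (one for each ordered pair $(i,j)$ with $j\in N(i)$): \begin{align*} &\sum_{j\in N[i]} x_j \ge 1 && \forall i\in V,\\ &y_{ij}-x_i\le 0 && \forall i\in V,\ \forall j\in N(i),\\ &\sum_{k\in N[i]} x_k-\sum_{k\in N(i)\cap N(j)} y_{kj}\ge 1 && \forall j\in V,\ \forall i\in V \text{ with } \mathrm{dist}(i,j)=2,\\ &x_j+\sum_{i\in N(j)} y_{ij}=1 && \forall j\in V,\\ &y_{ij}\ge 0 && \forall i\in V,\ \forall j\in N(i),\\ &x_j\in\{0,1\} && \forall j\in V. \end{align*} Then the solutions of this system correspond precisely to the secure dominating sets of $G$; that is, a set $S\subseteq V$ is a secure dominating set of $G$ if and only if there exist values of the variables $y_{ij}$ such that $x$, defined by $x_j=1$ if $j\in S$ and $x_j=0$ otherwise, together with these $y_{ij}$ satisfies all the constraints above.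
   Context: A set $D\subseteq V$ is a dominating set of $G$ if for every vertex $v\in V$ we have $N[v]\cap D\neq\emptyset$. A dominating set $D$ is secure if for every vertex $v\in V$ there exists a vertex $w\in N[v]\cap D$ such that $(D\setminus\{w\})\cup\{v\}$ is also a dominating set of $G$.
   Formalization: The variables $y_{ij}$ take values in ℚ instead of the reals. -}

module Defs where

open import Data.Nat using (ℕ; zero; suc)
open import Data.Bool using (Bool; true; false; if_then_else_; T)
open import Data.Fin using (Fin; zero; suc)
open import Data.Fin.Subset using (Subset; _∈_; _∉_; _∪_; _-_; ⁅_⁆)
open import Data.Vec using (lookup)
open import Data.Rational using (ℚ; 0ℚ; 1ℚ; _+_; _≤_) renaming (_-_ to _-ℚ_)
open import Data.Product using (Σ; ∃; _×_; _,_)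
open import Data.Sum using (_⊎_)
open import Relation.Binary.PropositionalEquality using (_≡_; _≢_)
open import Relation.Nullary using (¬_)

-- A finite simple undirected graph on the vertex set Fin n
-- (standing for {1,…,n}), given by a Boolean adjacency matrix
-- that is symmetric and irreflexive.
record Graph (n : ℕ) : Set where
  field
    adj   : Fin n → Fin n → Bool
    sym   : ∀ i j → adj i j ≡ adj j i
    irrefl : ∀ i → adj i i ≡ false

open Graph public

module _ {n : ℕ} (G : Graph n) where

  Adj : Fin n → Fin n → Set
  Adj i j = T (adj G i j)

  InClosedNbhd : Fin n → Fin n → Set
  InClosedNbhd i j = (j ≡ i) ⊎ Adj i j

  IsDominating : Subset n → Set
  IsDominating D = ∀ v → ∃ λ w → InClosedNbhd v w × w ∈ D

  IsSecureDominating : Subset n → Set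
  IsSecureDominating D =
    IsDominating D ×
    (∀ v → ∃ λ w → InClosedNbhd v w × w ∈ D × IsDominating ((D - w) ∪ ⁅ v ⁆))

  Dist2 : Fin n → Fin n → Set
  Dist2 i j = i ≢ j × ¬ Adj i j × ∃ λ k → Adj i k × Adj k j

Σᶠ : ∀ {n} → (Fin n → ℚ) → ℚ
Σᶠ {zero}  f = 0ℚ
Σᶠ {suc n} f = f zero + Σᶠ (λ i → f (suc i))

𝟙 : Bool → ℚ
𝟙 b = if b then 1ℚ else 0ℚ

module _ {n : ℕ} (G : Graph n) where

  ΣN : Fin n → (Fin n → ℚ) → ℚ
  ΣN i f = Σᶠ (λ j → if adj G i j then f j else 0ℚ)

  ΣN[] : Fin n → (Fin n → ℚ) → ℚ
  ΣN[] i f = f i + ΣN i f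

  ΣN∩ : Fin n → Fin n → (Fin n → ℚ) → ℚ
  ΣN∩ i j f = Σᶠ (λ k → if adj G i k then (if adj G j k then f k else 0ℚ) else 0ℚ)

  charVec : Subset n → Fin n → ℚ
  charVec S j = 𝟙 (lookup S j)

  -- The constraint system in (x , y); y i j is the variable y_{ij}
  -- (only the entries with j ∈ N(i) occur in the constraints).
  -- x_j ∈ {0,1} holds automatically since x is a characteristic vector.
  Feasible : (Fin n → ℚ) → (Fin n → Fin n → ℚ) → Set
  Feasible x y =
    (∀ i → 1ℚ ≤ ΣN[] i x) ×
    (∀ i j → Adj G i j → y i j ≤ x i) ×
    (∀ j i → Dist2 G i j → 1ℚ ≤ ΣN[] i x -ℚ ΣN∩ i j (λ k → y k j)) ×
    (∀ j → x j + ΣN j (λ i → y i j) ≡ 1ℚ) ×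
    (∀ i j → Adj G i j → 0ℚ ≤ y i j)

module Submission where

-- (⇒) For every vertex j choose a guard g(j) ∈ S ∩ N[j]: j itself if j ∈ S,
--     otherwise a neighbour whose swap with j keeps S dominating.  Put
--     y_kj = 1 iff k = g(j).  Then Σ_{i∈N(j)} y_ij = [j ∉ S], and for i at
--     distance 2 from j the common-neighbour sum is [g(j) ∈ N(i), j ∉ S]; in
--     that case the swapped set (S - g(j)) ∪ {j} still dominates i, which
--     gives a second vertex of S in N[i], so Σ_{k∈N[i]} x_k ≥ 2.
-- (⇐) The covering rows make S dominating.  For v ∉ S the balance row forces
--     some neighbour w with y_wv > 0, hence w ∈ S by y_wv ≤ x_w.  The swap
--     (S - w) ∪ {v} can only fail at a vertex u at distance 2 from v whose
--     unique S-vertex in N[u] is w; the distance-two row for (u , v) rules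
--     this out, since there Σ_{k∈N[u]} x_k ≥ 1 + y_wv > 1.

open import Defs hiding (sym)
open import Data.Nat using (ℕ)
open import Data.Bool using (true; false; if_then_else_; T; _∧_)
open import Data.Bool.Properties using (T-≡; T-∧)
open import Data.Unit using (tt)
open import Data.Empty using (⊥-elim)
open import Data.Fin using (Fin; zero; suc; _≟_)
open import Data.Fin.Properties using (any?; suc-injective)
open import Data.Fin.Subset using (Subset; _∈_; _∉_; _∪_; _─_; _-_; ⁅_⁆)
open import Data.Fin.Subset.Properties
  using (_∈?_; x∈⁅x⁆; x∈⁅y⁆⇒x≡y; x∈p∪q⁻; x∈p∪q⁺; x∈p∧x≢y⇒x∈p-y; p─q⊆p)
open import Data.Vec using (lookup; _∷_; here; there)
open import Data.Vec.Properties using ([]=⇒lookup; lookup⇒[]=)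
open import Data.Rational using (ℚ; 0ℚ; 1ℚ; _+_; -_; _≤_; _<_) renaming (_-_ to _-ℚ_)
open import Data.Rational.Properties
  using ( ≤-refl; ≤-reflexive; ≤-trans; ≤-antisym; <⇒≤; <-irrefl; <-≤-trans; ≮⇒≥; _<?_
        ; positive⁻¹; +-identityˡ; +-identityʳ; +-comm; +-mono-≤; +-monoˡ-≤; +-monoʳ-≤
        ; +-monoʳ-<; +-0-group )
open import Algebra.Properties.Group +-0-group using (//-rightDividesˡ; //-rightDividesʳ)
open import Data.Product using (∃; _×_; _,_; proj₁; proj₂)
open import Data.Sum using (_⊎_; inj₁; inj₂; [_,_])
open import Function using (_∘_; id)
open import Function.Bundles using (_⇔_; mk⇔; Equivalence)
open import Relation.Nullary using (¬_; Dec; yes; no; does; contradiction)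
open import Relation.Nullary.Decidable using (dec-true; dec-false; _×-dec_; _⊎-dec_; ¬?; T?)
open import Relation.Binary.PropositionalEquality
  using (_≡_; _≢_; refl; sym; trans; cong; cong₂; subst)
open Relation.Binary.PropositionalEquality.≡-Reasoning

0≤1 : 0ℚ ≤ 1ℚ
0≤1 = <⇒≤ (positive⁻¹ 1ℚ)

<⇒≱ : ∀ {p q} → p < q → ¬ (q ≤ p)
<⇒≱ p<q q≤p = <-irrefl refl (<-≤-trans p<q q≤p)

≤-+-nonNegʳ : ∀ {p q} → 0ℚ ≤ q → p ≤ p + q
≤-+-nonNegʳ {p} q≥0 = ≤-trans (≤-reflexive (sym (+-identityʳ p))) (+-monoʳ-≤ p q≥0)

≤-+-nonNegˡ : ∀ {p q} → 0ℚ ≤ q → p ≤ q + p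
≤-+-nonNegˡ {p} q≥0 = ≤-trans (≤-reflexive (sym (+-identityˡ p))) (+-monoˡ-≤ p q≥0)

+-nonPosʳ-≤ : ∀ {p q} → q ≤ 0ℚ → p + q ≤ p
+-nonPosʳ-≤ {p} q≤0 = ≤-trans (+-monoʳ-≤ p q≤0) (≤-reflexive (+-identityʳ p))

+-nonPosˡ-≤ : ∀ {p q} → q ≤ 0ℚ → q + p ≤ p
+-nonPosˡ-≤ {p} q≤0 = ≤-trans (+-monoˡ-≤ p q≤0) (≤-reflexive (+-identityˡ p))

+≤⇒≤- : ∀ {p q r} → r + q ≤ p → r ≤ p -ℚ q
+≤⇒≤- {p} {q} {r} h = subst (_≤ p -ℚ q) (//-rightDividesʳ q r) (+-monoˡ-≤ (- q) h)

≤-⇒+≤ : ∀ {p q r} → r ≤ p -ℚ q → r + q ≤ p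
≤-⇒+≤ {p} {q} {r} h = subst (r + q ≤_) (//-rightDividesˡ q p) (+-monoˡ-≤ q h)

if-T : ∀ {b} {p q : ℚ} → T b → (if b then p else q) ≡ p
if-T {true} _ = refl

if-zero : ∀ b {p} → p ≡ 0ℚ → (if b then p else 0ℚ) ≡ 0ℚ
if-zero true  p≡0 = p≡0
if-zero false _   = refl

if-nonNeg : ∀ b {p} → (T b → 0ℚ ≤ p) → 0ℚ ≤ (if b then p else 0ℚ)
if-nonNeg true  h = h tt
if-nonNeg false _ = ≤-refl

if-positive : ∀ b {p} → 0ℚ < (if b then p else 0ℚ) → T b × 0ℚ < p
if-positive true  p>0 = tt , p>0
if-positive false 0<0 = ⊥-elim (<-irrefl refl 0<0)

if-𝟙 : ∀ a b → (if a then 𝟙 b else 0ℚ) ≡ 𝟙 (a ∧ b)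
if-𝟙 true  b = refl
if-𝟙 false b = refl

𝟙-nonNeg : ∀ b → 0ℚ ≤ 𝟙 b
𝟙-nonNeg true  = 0≤1
𝟙-nonNeg false = ≤-refl

1+𝟙-≤ : ∀ b {p} → 1ℚ ≤ p → (T b → 1ℚ + 1ℚ ≤ p) → 1ℚ + 𝟙 b ≤ p
1+𝟙-≤ true  _   two = two tt
1+𝟙-≤ false one _   = one

Σ-nonNeg : ∀ {n} (f : Fin n → ℚ) → (∀ k → 0ℚ ≤ f k) → 0ℚ ≤ Σᶠ f
Σ-nonNeg {ℕ.zero}  f f≥0 = ≤-refl
Σ-nonNeg {ℕ.suc n} f f≥0 = +-mono-≤ (f≥0 zero) (Σ-nonNeg (f ∘ suc) (f≥0 ∘ suc))

Σ-nonPos : ∀ {n} (f : Fin n → ℚ) → (∀ k → f k ≤ 0ℚ) → Σᶠ f ≤ 0ℚ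
Σ-nonPos {ℕ.zero}  f f≤0 = ≤-refl
Σ-nonPos {ℕ.suc n} f f≤0 = +-mono-≤ (f≤0 zero) (Σ-nonPos (f ∘ suc) (f≤0 ∘ suc))

Σ-zero : ∀ {n} (f : Fin n → ℚ) → (∀ k → f k ≡ 0ℚ) → Σᶠ f ≡ 0ℚ
Σ-zero f f≡0 = ≤-antisym (Σ-nonPos f (≤-reflexive ∘ f≡0)) (Σ-nonNeg f (≤-reflexive ∘ sym ∘ f≡0))

Σ-supported : ∀ {n} (f : Fin n → ℚ) a → (∀ k → k ≢ a → f k ≡ 0ℚ) → Σᶠ f ≡ f a
Σ-supported {ℕ.suc n} f zero h = begin
  f zero + Σᶠ (f ∘ suc) ≡⟨ cong (f zero +_) (Σ-zero (f ∘ suc) (λ k → h (suc k) (λ ()))) ⟩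
  f zero + 0ℚ           ≡⟨ +-identityʳ (f zero) ⟩
  f zero                ∎
Σ-supported {ℕ.suc n} f (suc a) h = begin
  f zero + Σᶠ (f ∘ suc) ≡⟨ cong₂ _+_ (h zero (λ ())) Σ-tail ⟩
  0ℚ + f (suc a)        ≡⟨ +-identityˡ (f (suc a)) ⟩
  f (suc a)             ∎
  where
  Σ-tail : Σᶠ (f ∘ suc) ≡ f (suc a)
  Σ-tail = Σ-supported (f ∘ suc) a (λ k k≢a → h (suc k) (k≢a ∘ suc-injective))

Σ-term-≤ : ∀ {n} (f : Fin n → ℚ) → (∀ k → 0ℚ ≤ f k) → ∀ a → f a ≤ Σᶠ f
Σ-term-≤ {ℕ.suc n} f f≥0 zero    = ≤-+-nonNegʳ (Σ-nonNeg (f ∘ suc) (f≥0 ∘ suc))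
Σ-term-≤ {ℕ.suc n} f f≥0 (suc a) =
  ≤-trans (Σ-term-≤ (f ∘ suc) (f≥0 ∘ suc) a) (≤-+-nonNegˡ (f≥0 zero))

Σ-two-terms-≤ : ∀ {n} (f : Fin n → ℚ) → (∀ k → 0ℚ ≤ f k) →
                ∀ a b → a ≢ b → f a + f b ≤ Σᶠ f
Σ-two-terms-≤ {ℕ.suc n} f f≥0 zero    zero    a≢b = contradiction refl a≢b
Σ-two-terms-≤ {ℕ.suc n} f f≥0 zero    (suc b) _   =
  +-monoʳ-≤ (f zero) (Σ-term-≤ (f ∘ suc) (f≥0 ∘ suc) b)
Σ-two-terms-≤ {ℕ.suc n} f f≥0 (suc a) zero    _   =
  ≤-trans (≤-reflexive (+-comm (f (suc a)) (f zero)))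
          (+-monoʳ-≤ (f zero) (Σ-term-≤ (f ∘ suc) (f≥0 ∘ suc) a))
Σ-two-terms-≤ {ℕ.suc n} f f≥0 (suc a) (suc b) a≢b =
  ≤-trans (Σ-two-terms-≤ (f ∘ suc) (f≥0 ∘ suc) a b (a≢b ∘ cong suc)) (≤-+-nonNegˡ (f≥0 zero))

Σ-≤-term : ∀ {n} (f : Fin n → ℚ) a → (∀ k → k ≢ a → f k ≤ 0ℚ) → Σᶠ f ≤ f a
Σ-≤-term {ℕ.suc n} f zero    h = +-nonPosʳ-≤ (Σ-nonPos (f ∘ suc) (λ k → h (suc k) (λ ())))
Σ-≤-term {ℕ.suc n} f (suc a) h =
  ≤-trans (+-nonPosˡ-≤ (h zero (λ ())))
          (Σ-≤-term (f ∘ suc) a (λ k k≢a → h (suc k) (k≢a ∘ suc-injective)))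

Σ-positive-term : ∀ {n} (f : Fin n → ℚ) → 0ℚ < Σᶠ f → ∃ λ k → 0ℚ < f k
Σ-positive-term f Σ>0 with any? (λ k → 0ℚ <? f k)
... | yes found = found
... | no none   = contradiction (Σ-nonPos f (λ k → ≮⇒≥ (λ fk>0 → none (k , fk>0)))) (<⇒≱ Σ>0)

Σ-other-positive-term : ∀ {n} (f : Fin n → ℚ) a → f a < Σᶠ f → ∃ λ k → k ≢ a × 0ℚ < f k
Σ-other-positive-term f a Σ>fa with any? (λ k → ¬? (k ≟ a) ×-dec (0ℚ <? f k))
... | yes found = found
... | no none   =
  contradiction (Σ-≤-term f a (λ k k≢a → ≮⇒≥ (λ fk>0 → none (k , k≢a , fk>0)))) (<⇒≱ Σ>fa)

δ : ∀ {n} → Fin n → Fin n → ℚ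
δ g k = 𝟙 (does (k ≟ g))

δ-self : ∀ {n} (g : Fin n) → δ g g ≡ 1ℚ
δ-self g = cong 𝟙 (dec-true (g ≟ g) refl)

δ-other : ∀ {n} {g k : Fin n} → k ≢ g → δ g k ≡ 0ℚ
δ-other {g = g} {k} k≢g = cong 𝟙 (dec-false (k ≟ g) k≢g)

x∈p─q⇒x∉q : ∀ {n} (p q : Subset n) {x} → x ∈ p ─ q → x ∉ q
x∈p─q⇒x∉q (true  ∷ p) (true ∷ q) ()            here
x∈p─q⇒x∉q (false ∷ p) (true ∷ q) ()            here
x∈p─q⇒x∉q (_     ∷ p) (_    ∷ q) (there x∈p─q) (there x∈q) = x∈p─q⇒x∉q p q x∈p─q x∈q

∈-swap⁺ : ∀ {n} {S : Subset n} {v w z} → z ∈ S → z ≢ w → z ∈ (S - w) ∪ ⁅ v ⁆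
∈-swap⁺ z∈S z≢w = x∈p∪q⁺ (inj₁ (x∈p∧x≢y⇒x∈p-y z∈S z≢w))

v∈swap : ∀ {n} {S : Subset n} {w} v → v ∈ (S - w) ∪ ⁅ v ⁆
v∈swap v = x∈p∪q⁺ (inj₂ (x∈⁅x⁆ v))

∈-swap⁻ : ∀ {n} (S : Subset n) {v w z} → z ∈ (S - w) ∪ ⁅ v ⁆ → z ≡ v ⊎ (z ∈ S × z ≢ w)
∈-swap⁻ S {v} {w} {z} z∈swap with x∈p∪q⁻ (S - w) ⁅ v ⁆ z∈swap
... | inj₂ z∈⁅v⁆ = inj₁ (x∈⁅y⁆⇒x≡y v z∈⁅v⁆)
... | inj₁ z∈S-w = inj₂ (p─q⊆p S ⁅ w ⁆ z∈S-w , λ { refl → x∈p─q⇒x∉q S ⁅ w ⁆ z∈S-w (x∈⁅x⁆ w) })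

module _ {n : ℕ} (G : Graph n) where

  Adj-sym : ∀ {i j} → Adj G i j → Adj G j i
  Adj-sym {i} {j} = subst T (Graph.sym G i j)

  Adj⇒≢ : ∀ {i j} → Adj G i j → i ≢ j
  Adj⇒≢ {i} i~i refl = subst T (irrefl G i) i~i

  InClosedNbhd? : ∀ i j → Dec (InClosedNbhd G i j)
  InClosedNbhd? i j = (j ≟ i) ⊎-dec T? (adj G i j)

  Dist2⇒∉N[] : ∀ {i j} → Dist2 G i j → ¬ InClosedNbhd G i j
  Dist2⇒∉N[] (i≢j , i≁j , _) = [ i≢j ∘ sym , i≁j ]

  ∉N[]⇒Dist2 : ∀ {i j k} → ¬ InClosedNbhd G i j → Adj G i k → Adj G k j → Dist2 G i j
  ∉N[]⇒Dist2 {k = k} j∉N[i] i~k k~j = (j∉N[i] ∘ inj₁ ∘ sym) , (j∉N[i] ∘ inj₂) , k , i~k , k~j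

  restrict : Fin n → (Fin n → ℚ) → Fin n → ℚ
  restrict i f k = if adj G i k then f k else 0ℚ

  restrict-nonNeg : ∀ i (f : Fin n → ℚ) → (∀ k → Adj G i k → 0ℚ ≤ f k) →
                    ∀ k → 0ℚ ≤ restrict i f k
  restrict-nonNeg i f f≥0 k = if-nonNeg (adj G i k) (f≥0 k)

  ΣN-term-≤ : ∀ i (f : Fin n → ℚ) → (∀ k → Adj G i k → 0ℚ ≤ f k) →
              ∀ {a} → Adj G i a → f a ≤ ΣN G i f
  ΣN-term-≤ i f f≥0 {a} i~a =
    subst (_≤ ΣN G i f) (if-T i~a) (Σ-term-≤ (restrict i f) (restrict-nonNeg i f f≥0) a)

  ΣN-two-terms-≤ : ∀ i (f : Fin n → ℚ) → (∀ k → Adj G i k → 0ℚ ≤ f k) →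
                   ∀ {a b} → Adj G i a → Adj G i b → a ≢ b → f a + f b ≤ ΣN G i f
  ΣN-two-terms-≤ i f f≥0 {a} {b} i~a i~b a≢b =
    subst (_≤ ΣN G i f) (cong₂ _+_ (if-T i~a) (if-T i~b))
          (Σ-two-terms-≤ (restrict i f) (restrict-nonNeg i f f≥0) a b a≢b)

  -- ΣN∩ G i j f is by definition ΣN G i (restrict j f).
  ΣN∩-term-≤ : ∀ i j (f : Fin n → ℚ) → (∀ k → Adj G i k → Adj G j k → 0ℚ ≤ f k) →
               ∀ {a} → Adj G i a → Adj G j a → f a ≤ ΣN∩ G i j f
  ΣN∩-term-≤ i j f f≥0 i~a j~a =
    subst (_≤ ΣN∩ G i j f) (if-T j~a)
          (ΣN-term-≤ i (restrict j f) (λ k i~k → if-nonNeg (adj G j k) (f≥0 k i~k)) i~a)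

  ΣN[]-term-≤ : ∀ i (f : Fin n → ℚ) → (∀ k → InClosedNbhd G i k → 0ℚ ≤ f k) →
                ∀ {a} → InClosedNbhd G i a → f a ≤ ΣN[] G i f
  ΣN[]-term-≤ i f f≥0 (inj₁ refl) =
    ≤-+-nonNegʳ (Σ-nonNeg (restrict i f) (restrict-nonNeg i f (λ k → f≥0 k ∘ inj₂)))
  ΣN[]-term-≤ i f f≥0 (inj₂ i~a) =
    ≤-trans (ΣN-term-≤ i f (λ k → f≥0 k ∘ inj₂) i~a) (≤-+-nonNegˡ (f≥0 i (inj₁ refl)))

  ΣN[]-two-terms-≤ : ∀ i (f : Fin n → ℚ) → (∀ k → InClosedNbhd G i k → 0ℚ ≤ f k) →
                     ∀ {a b} → InClosedNbhd G i a → Adj G i b → a ≢ b → f a + f b ≤ ΣN[] G i f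
  ΣN[]-two-terms-≤ i f f≥0 (inj₁ refl) i~b _ =
    +-monoʳ-≤ (f i) (ΣN-term-≤ i f (λ k → f≥0 k ∘ inj₂) i~b)
  ΣN[]-two-terms-≤ i f f≥0 (inj₂ i~a) i~b a≢b =
    ≤-trans (ΣN-two-terms-≤ i f (λ k → f≥0 k ∘ inj₂) i~a i~b a≢b) (≤-+-nonNegˡ (f≥0 i (inj₁ refl)))

  ΣN-positive-term : ∀ i (f : Fin n → ℚ) → 0ℚ < ΣN G i f → ∃ λ k → Adj G i k × 0ℚ < f k
  ΣN-positive-term i f Σ>0 with Σ-positive-term (restrict i f) Σ>0
  ... | k , term>0 = k , if-positive (adj G i k) term>0

  ΣN[]-positive-term : ∀ i (f : Fin n → ℚ) → 0ℚ < ΣN[] G i f →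
                       ∃ λ k → InClosedNbhd G i k × 0ℚ < f k
  ΣN[]-positive-term i f Σ>0 with 0ℚ <? f i
  ... | yes fi>0 = i , inj₁ refl , fi>0
  ... | no  fi≯0 with ΣN-positive-term i f (<-≤-trans Σ>0 (+-nonPosˡ-≤ (≮⇒≥ fi≯0)))
  ...   | k , i~k , fk>0 = k , inj₂ i~k , fk>0

  ΣN[]-other-positive-term : ∀ i (f : Fin n → ℚ) {a} → Adj G i a → f a < ΣN[] G i f →
                             ∃ λ k → InClosedNbhd G i k × k ≢ a × 0ℚ < f k
  ΣN[]-other-positive-term i f {a} i~a Σ>fa with 0ℚ <? f i
  ... | yes fi>0 = i , inj₁ refl , Adj⇒≢ i~a , fi>0
  ... | no  fi≯0 with Σ-other-positive-term (restrict i f) a restricted-bound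
    where
    restricted-bound : restrict i f a < ΣN G i f
    restricted-bound = subst (_< ΣN G i f) (sym (if-T i~a))
                             (<-≤-trans Σ>fa (+-nonPosˡ-≤ (≮⇒≥ fi≯0)))
  ...   | k , k≢a , term>0 with if-positive (adj G i k) term>0
  ...     | i~k , fk>0 = k , inj₂ i~k , k≢a , fk>0

  ΣN-δ : ∀ i g → ΣN G i (δ g) ≡ 𝟙 (adj G i g)
  ΣN-δ i g = begin
    ΣN G i (δ g)                     ≡⟨ Σ-supported (restrict i (δ g)) g off-g ⟩
    (if adj G i g then δ g g else 0ℚ) ≡⟨ cong (if adj G i g then_else 0ℚ) (δ-self g) ⟩
    𝟙 (adj G i g)                    ∎
    where
    off-g : ∀ k → k ≢ g → restrict i (δ g) k ≡ 0ℚ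
    off-g k k≢g = if-zero (adj G i k) (δ-other k≢g)

  ΣN∩-δ : ∀ i j g → ΣN∩ G i j (δ g) ≡ 𝟙 (adj G i g ∧ adj G j g)
  ΣN∩-δ i j g = begin
    ΣN∩ G i j (δ g)                        ≡⟨ Σ-supported (restrict i (restrict j (δ g))) g off-g ⟩
    (if adj G i g then restrict j (δ g) g else 0ℚ)
      ≡⟨ cong (λ t → if adj G i g then (if adj G j g then t else 0ℚ) else 0ℚ) (δ-self g) ⟩
    (if adj G i g then 𝟙 (adj G j g) else 0ℚ) ≡⟨ if-𝟙 (adj G i g) (adj G j g) ⟩
    𝟙 (adj G i g ∧ adj G j g)              ∎
    where
    off-g : ∀ k → k ≢ g → restrict i (restrict j (δ g)) k ≡ 0ℚ
    off-g k k≢g = if-zero (adj G i k) (if-zero (adj G j k) (δ-other k≢g))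

  module _ (S : Subset n) where

    second-dominator : ∀ {i j w} → IsDominating G ((S - w) ∪ ⁅ j ⁆) → ¬ InClosedNbhd G i j →
                       ∃ λ z → InClosedNbhd G i z × z ≢ w × z ∈ S
    second-dominator {i} dom′ j∉N[i] with dom′ i
    ... | z , i~z , z∈swap with ∈-swap⁻ S z∈swap
    ...   | inj₁ refl          = contradiction i~z j∉N[i]
    ...   | inj₂ (z∈S , z≢w) = z , i~z , z≢w , z∈S

    swap-dominating : ∀ {v w} → IsDominating G S → Adj G v w →
                      (∀ u → Dist2 G u v → Adj G u w → ∃ λ z → InClosedNbhd G u z × z ≢ w × z ∈ S) →
                      IsDominating G ((S - w) ∪ ⁅ v ⁆)
    swap-dominating {v} {w} dom v~w spare u with dom u
    ... | z , u~z , z∈S with z ≟ w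
    ...   | no  z≢w  = z , u~z , ∈-swap⁺ z∈S z≢w
    ...   | yes refl with InClosedNbhd? u v
    ...     | yes u~v = v , u~v , v∈swap v
    ...     | no  v∉N[u] with spare u (∉N[]⇒Dist2 v∉N[u] u~w (Adj-sym v~w)) u~w
      where
      u~w : Adj G u w
      u~w = [ (λ { refl → contradiction (inj₂ (Adj-sym v~w)) v∉N[u] }) , id ] u~z
    ...       | z′ , u~z′ , z′≢w , z′∈S = z′ , u~z′ , ∈-swap⁺ z′∈S z′≢w

    self-swap-dominating : ∀ {v} → IsDominating G S → IsDominating G ((S - v) ∪ ⁅ v ⁆)
    self-swap-dominating {v} dom u with dom u
    ... | z , u~z , z∈S with z ≟ v
    ...   | yes refl = v , u~z , v∈swap v
    ...   | no  z≢v  = z , u~z , ∈-swap⁺ z∈S z≢v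

    x : Fin n → ℚ
    x = charVec G S

    x∈ : ∀ {j} → j ∈ S → x j ≡ 1ℚ
    x∈ j∈S = cong 𝟙 ([]=⇒lookup j∈S)

    x∉ : ∀ {j} → j ∉ S → x j ≡ 0ℚ
    x∉ {j} j∉S with lookup S j in eq
    ... | true  = contradiction (lookup⇒[]= j S eq) j∉S
    ... | false = refl

    x-nonNeg : ∀ j → 0ℚ ≤ x j
    x-nonNeg j = 𝟙-nonNeg (lookup S j)

    x-positive⇒∈ : ∀ {j} → 0ℚ < x j → j ∈ S
    x-positive⇒∈ {j} xj>0 with j ∈? S
    ... | yes j∈S = j∈S
    ... | no  j∉S = contradiction (subst (0ℚ <_) (x∉ j∉S) xj>0) (<-irrefl refl)

    covering : IsDominating G S → ∀ i → 1ℚ ≤ ΣN[] G i x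
    covering dom i with dom i
    ... | z , i~z , z∈S = subst (_≤ ΣN[] G i x) (x∈ z∈S) (ΣN[]-term-≤ i x (λ k _ → x-nonNeg k) i~z)

    data Guard (j : Fin n) : Fin n → Set where
      itself    : j ∈ S → Guard j j
      neighbour : ∀ {g} → j ∉ S → Adj G j g → g ∈ S →
                  IsDominating G ((S - g) ∪ ⁅ j ⁆) → Guard j g

    guard-∈ : ∀ {j g} → Guard j g → g ∈ S
    guard-∈ (itself j∈S)          = j∈S
    guard-∈ (neighbour _ _ g∈S _) = g∈S

    guard-exists : IsSecureDominating G S → ∀ j → ∃ (Guard j)
    guard-exists (_ , secure) j with j ∈? S | secure j
    ... | yes j∈S | _                          = j , itself j∈S
    ... | no  j∉S | g , inj₁ refl , g∈S , _    = contradiction g∈S j∉S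
    ... | no  j∉S | g , inj₂ j~g , g∈S , dom′ = g , neighbour j∉S j~g g∈S dom′

    δ-≤-x : ∀ {g} → g ∈ S → ∀ i → δ g i ≤ x i
    δ-≤-x {g} g∈S i with i ≟ g
    ... | yes refl = ≤-reflexive (sym (x∈ g∈S))
    ... | no  _    = x-nonNeg i

    -- Balance row: j is either in S or watched by exactly one neighbour.
    guard-balance : ∀ {j g} → Guard j g → x j + ΣN G j (δ g) ≡ 1ℚ
    guard-balance {j} (itself j∈S) =
      cong₂ _+_ (x∈ j∈S) (trans (ΣN-δ j j) (cong 𝟙 (irrefl G j)))
    guard-balance {j} {g} (neighbour j∉S j~g _ _) =
      cong₂ _+_ (x∉ j∉S) (trans (ΣN-δ j g) (cong 𝟙 (Equivalence.to T-≡ j~g)))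

    guard-distance-two : ∀ {i j g} → IsDominating G S → Guard j g → Dist2 G i j →
                         1ℚ + ΣN∩ G i j (δ g) ≤ ΣN[] G i x
    guard-distance-two {i} {j} {g} dom guard d =
      subst (λ t → 1ℚ + t ≤ ΣN[] G i x) (sym (ΣN∩-δ i j g))
            (1+𝟙-≤ (adj G i g ∧ adj G j g) (covering dom i) (two-dominators guard ∘ proj₁ ∘ Equivalence.to T-∧))
      where
      two-dominators : ∀ {g} → Guard j g → Adj G i g → 1ℚ + 1ℚ ≤ ΣN[] G i x
      two-dominators (itself _) i~j = contradiction (inj₂ i~j) (Dist2⇒∉N[] d)
      two-dominators {g} (neighbour _ _ g∈S dom′) i~g with second-dominator dom′ (Dist2⇒∉N[] d)
      ... | z , i~z , z≢g , z∈S =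
        subst (_≤ ΣN[] G i x) (cong₂ _+_ (x∈ z∈S) (x∈ g∈S))
              (ΣN[]-two-terms-≤ i x (λ k _ → x-nonNeg k) i~z i~g z≢g)

    -- Secure ⇒ feasible: y_kj is the indicator of k being the guard of j.
    secure⇒feasible : IsSecureDominating G S → ∃ λ y → Feasible G x y
    secure⇒feasible secure = y , covering dom , capacity , distance-two , balance , nonNeg
      where
      dom : IsDominating G S
      dom = proj₁ secure
      guard : ∀ j → ∃ (Guard j)
      guard = guard-exists secure
      y : Fin n → Fin n → ℚ
      y k j = δ (proj₁ (guard j)) k
      capacity : ∀ i j → Adj G i j → y i j ≤ x i
      capacity i j _ = δ-≤-x (guard-∈ (proj₂ (guard j))) i
      distance-two : ∀ j i → Dist2 G i j → 1ℚ ≤ ΣN[] G i x -ℚ ΣN∩ G i j (λ k → y k j)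
      distance-two j i d = +≤⇒≤- (guard-distance-two dom (proj₂ (guard j)) d)
      balance : ∀ j → x j + ΣN G j (λ i → y i j) ≡ 1ℚ
      balance j = guard-balance (proj₂ (guard j))
      nonNeg : ∀ i j → Adj G i j → 0ℚ ≤ y i j
      nonNeg i j _ = 𝟙-nonNeg _

    covering⇒dominating : (∀ i → 1ℚ ≤ ΣN[] G i x) → IsDominating G S
    covering⇒dominating cover i with ΣN[]-positive-term i x (<-≤-trans (positive⁻¹ 1ℚ) (cover i))
    ... | k , i~k , xk>0 = k , i~k , x-positive⇒∈ xk>0

    module _ (y : Fin n → Fin n → ℚ) where

      watcher : (∀ i j → Adj G i j → y i j ≤ x i) →
                ∀ {v} → x v + ΣN G v (λ i → y i v) ≡ 1ℚ → v ∉ S →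
                ∃ λ w → Adj G v w × w ∈ S × 0ℚ < y w v
      watcher capacity {v} balance v∉S with ΣN-positive-term v (λ i → y i v) ΣN>0
        where
        ΣN≡1 : ΣN G v (λ i → y i v) ≡ 1ℚ
        ΣN≡1 = begin
          ΣN G v (λ i → y i v)                 ≡⟨ +-identityˡ _ ⟨
          0ℚ + ΣN G v (λ i → y i v)            ≡⟨ cong (_+ ΣN G v (λ i → y i v)) (x∉ v∉S) ⟨
          x v + ΣN G v (λ i → y i v) ≡⟨ balance ⟩
          1ℚ                                   ∎
        ΣN>0 : 0ℚ < ΣN G v (λ i → y i v)
        ΣN>0 = subst (0ℚ <_) (sym ΣN≡1) (positive⁻¹ 1ℚ)
      ... | w , v~w , ywv>0 =
        w , v~w , x-positive⇒∈ (<-≤-trans ywv>0 (capacity w v (Adj-sym v~w))) , ywv>0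

      spare : (∀ i j → Adj G i j → 0ℚ ≤ y i j) →
              ∀ {u v w} → 1ℚ ≤ ΣN[] G u x -ℚ ΣN∩ G u v (λ k → y k v) →
              Adj G u w → Adj G v w → w ∈ S → 0ℚ < y w v →
              ∃ λ z → InClosedNbhd G u z × z ≢ w × z ∈ S
      spare nonNeg {u} {v} {w} row u~w v~w w∈S ywv>0
        with ΣN[]-other-positive-term u x u~w xw<ΣN[]
        where
        common≥ : y w v ≤ ΣN∩ G u v (λ k → y k v)
        common≥ = ΣN∩-term-≤ u v (λ k → y k v) (λ k _ v~k → nonNeg k v (Adj-sym v~k)) u~w v~w
        xw<ΣN[] : x w < ΣN[] G u x
        xw<ΣN[] = subst (_< ΣN[] G u x) (sym (x∈ w∈S))
          (<-≤-trans (+-monoʳ-< 1ℚ ywv>0) (≤-trans (+-monoʳ-≤ 1ℚ common≥) (≤-⇒+≤ row)))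
      ... | z , u~z , z≢w , xz>0 = z , u~z , z≢w , x-positive⇒∈ xz>0

      feasible⇒secure : Feasible G x y → IsSecureDominating G S
      feasible⇒secure (cover , capacity , distance-two , balance , nonNeg) = dom , defend
        where
        dom : IsDominating G S
        dom = covering⇒dominating cover
        defend : ∀ v → ∃ λ w → InClosedNbhd G v w × w ∈ S × IsDominating G ((S - w) ∪ ⁅ v ⁆)
        defend v with v ∈? S
        ... | yes v∈S = v , inj₁ refl , v∈S , self-swap-dominating dom
        ... | no  v∉S with watcher capacity (balance v) v∉S
        ...   | w , v~w , w∈S , ywv>0 = w , inj₂ v~w , w∈S , swap-dominating dom v~w
                (λ u d u~w → spare nonNeg (distance-two v u d) u~w v~w w∈S ywv>0)

theorem1 : (n : ℕ) (G : Graph n) (S : Subset n) →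
    IsSecureDominating G S ⇔ ∃ λ (y : Fin n → Fin n → ℚ) → Feasible G (charVec G S) y
theorem1 n G S = mk⇔ (secure⇒feasible G S) (λ (y , feasible) → feasible⇒secure G S y feasible)
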